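{- Let $(t(n))_{n\ge0}$ be the Thue–Morse sequence ($t(0)=0$, $t(2n)=t(n)$, $t(2n+1)=1-t(n)$). Let $(a(n))_{n\ge0}$ be the increasing enumeration (indexed from $0$) of the odious numbers (nonnegative integers with odd binary digit sum) and $(b(n))_{n\ge0}$ that of the evil numbers (nonnegative integers with even binary digit sum). Then for all $n\ge0$: (i) $a(a(n))=2a(n)$; (ii) $b(b(n))=2b(n)$; (iii) $a(b(n))=2b(n)+1$; (iv) $b(a(n))=2a(n)+1$; (v) $a(a(n))=b(a(n))-1$; (vi) $b(b(n))=a(b(n))-1$; (vii) $a(n)-b(n)=1-2t(n)$ (in particular $a(n)-b(n)\in\{1,-1\}$); (viii) $a(b(n))-b(a(n))=4t(n)-2$ (in particular $a(b(n))-b(a(n))\in\{2,-2\}$). -}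

module Defs where

open import Data.Nat using (ℕ; zero; suc; _+_; _*_; _∸_; _<_; _%_; _/_)
open import Data.Nat.Properties using (_≟_)
open import Data.Fin using (toℕ)
open import Data.List using (map)
open import Data.Nat.ListAction using (sum)
open import Data.Product using (proj₁; _×_; ∃)
open import Data.Digit using (toDigits)
open import Relation.Binary.PropositionalEquality using (_≡_)
open import Relation.Nullary using (¬_)

-- Thue–Morse: t(0)=0, t(2n)=t(n), t(2n+1)=1-t(n).
-- Implemented with fuel; fuel n suffices since n/2 < n for n > 0.
tmFuel : ℕ → ℕ → ℕ
tmFuel zero    n = 0
tmFuel (suc f) zero = 0
tmFuel (suc f) n@(suc _) with n % 2
... | zero = tmFuel f (n / 2)
... | suc _ = 1 ∸ tmFuel f (n / 2)

t : ℕ → ℕ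
t n = tmFuel n n

binDigitSum : ℕ → ℕ
binDigitSum n = sum (map toℕ (proj₁ (toDigits 2 n)))

Odious : ℕ → Set
Odious m = binDigitSum m % 2 ≡ 1

Evil : ℕ → Set
Evil m = binDigitSum m % 2 ≡ 0

IsIncreasingEnumeration : (ℕ → Set) → (ℕ → ℕ) → Set
IsIncreasingEnumeration P f =
  (∀ m n → m < n → f m < f n) ×
  (∀ n → P (f n)) ×
  (∀ m → P m → ∃ λ n → f n ≡ m)

{-# OPTIONS --safe #-}
-- Appending a binary digit r to k adds r to the digit sum, so of the pair 2k, 2k + 1 exactly
-- one has digit-sum parity s, namely 2k + (s ⊕ t(k)), with t(k) the digit-sum parity of k
-- (t satisfies the same halving recurrence). The increasing enumeration of a set is unique,
-- hence a(k) = 2k + 1 − t(k) and b(k) = 2k + t(k); (i)–(iv) evaluate these at numbers of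
-- known parity, and (v)–(viii) are integer arithmetic on (i)–(iv) and a(k) − b(k) = 1 − 2t(k).
module Submission where

open import Defs
open import Data.Nat using (ℕ; zero; suc; _+_; _*_; _∸_; _≤_; _<_; z≤n; s≤s; s≤s⁻¹; _%_; _/_)
open import Data.Nat.Properties
open import Data.Nat.DivMod using (m≡m%n+[m/n]*n; m%n<n; m<n⇒m%n≡m; [m+kn]%n≡m%n; %-distribˡ-+; m/n<m)
open import Data.Nat.Induction using (<-rec)
open import Data.Integer using (ℤ; +_; _-_; -_; _⊖_)
import Data.Integer as ℤ
import Data.Integer.Properties as ℤₚ
open import Data.Integer.Tactic.RingSolver using (solve-∀)
open import Data.Product using (_×_; _,_; proj₁; proj₂; ∃)
open import Data.Fin using (Fin; toℕ; fromℕ<) renaming (zero to fzero)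
open import Data.Fin.Properties using (toℕ-injective; toℕ<n; toℕ-fromℕ<)
open import Data.List using ([]; _∷_; map)
open import Data.Nat.ListAction using (sum)
open import Data.Digit using (Expansion; fromDigits; toDigits)
open import Relation.Nullary using (contradiction)
open import Relation.Binary.Definitions using (tri<; tri≈; tri>)
open import Relation.Binary.PropositionalEquality

digitSum : ∀ {b} → Expansion b → ℕ
digitSum ds = sum (map toℕ ds)

module _ {b : ℕ} where

  lowestDigit-injective : ∀ (d e : Fin (suc b)) x y →
                          toℕ d + x * suc b ≡ toℕ e + y * suc b → d ≡ e × x ≡ y
  lowestDigit-injective d e x y eq = d≡e , *-cancelʳ-≡ x y (suc b) (+-cancelˡ-≡ (toℕ d) _ _ eq′)
    where
    lowestDigit : ∀ (c : Fin (suc b)) z → (toℕ c + z * suc b) % suc b ≡ toℕ c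
    lowestDigit c z = trans ([m+kn]%n≡m%n (toℕ c) z (suc b)) (m<n⇒m%n≡m (toℕ<n c))
    d≡e : d ≡ e
    d≡e = toℕ-injective (trans (sym (lowestDigit d x)) (trans (cong (_% suc b) eq) (lowestDigit e y)))
    eq′ : toℕ d + x * suc b ≡ toℕ d + y * suc b
    eq′ = trans eq (cong (λ c → toℕ c + y * suc b) (sym d≡e))

  -- Expansions may end in zero digits, so equal values need not have equal expansions.
  digitSum-unique : ∀ (ds es : Expansion (suc b)) →
                    fromDigits ds ≡ fromDigits es → digitSum ds ≡ digitSum es
  digitSum-unique [] [] _ = refl
  digitSum-unique [] (e ∷ es) eq with lowestDigit-injective fzero e 0 (fromDigits es) eq
  ... | refl , 0≡es = digitSum-unique [] es 0≡es
  digitSum-unique (d ∷ ds) [] eq with lowestDigit-injective d fzero (fromDigits ds) 0 eq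
  ... | refl , ds≡0 = digitSum-unique ds [] ds≡0
  digitSum-unique (d ∷ ds) (e ∷ es) eq with lowestDigit-injective d e (fromDigits ds) (fromDigits es) eq
  ... | refl , ds≡es = cong (λ s → toℕ d + s) (digitSum-unique ds es ds≡es)

binDigitSum-fromDigits : ∀ ds → binDigitSum (fromDigits ds) ≡ digitSum ds
binDigitSum-fromDigits ds = digitSum-unique (proj₁ (toDigits 2 (fromDigits ds))) ds (proj₂ (toDigits 2 _))

binDigitSum-+* : ∀ {r} n → r < 2 → binDigitSum (r + n * 2) ≡ r + binDigitSum n
binDigitSum-+* {r} n r<2 = begin
  binDigitSum (r + n * 2)                ≡⟨ cong binDigitSum (cong₂ (λ c m → c + m * 2) (sym (toℕ-fromℕ< r<2)) (sym n≡ds)) ⟩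
  binDigitSum (fromDigits (d ∷ ds))       ≡⟨ binDigitSum-fromDigits (d ∷ ds) ⟩
  toℕ d + binDigitSum n                  ≡⟨ cong (_+ binDigitSum n) (toℕ-fromℕ< r<2) ⟩
  r + binDigitSum n                      ∎
  where
  open ≡-Reasoning
  d : Fin 2
  d = fromℕ< r<2
  ds : Expansion 2
  ds = proj₁ (toDigits 2 n)
  n≡ds : fromDigits ds ≡ n
  n≡ds = proj₂ (toDigits 2 n)

infixl 7 _⊕_

_⊕_ : ℕ → ℕ → ℕ
r ⊕ s = (r + s) % 2

⊕<2 : ∀ r s → r ⊕ s < 2
⊕<2 r s = m%n<n (r + s) 2

⊕-cancelʳ : ∀ {r s} → r < 2 → s < 2 → r ⊕ s ⊕ s ≡ r
⊕-cancelʳ (s≤s z≤n)       (s≤s z≤n)       = refl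
⊕-cancelʳ (s≤s z≤n)       (s≤s (s≤s z≤n)) = refl
⊕-cancelʳ (s≤s (s≤s z≤n)) (s≤s z≤n)       = refl
⊕-cancelʳ (s≤s (s≤s z≤n)) (s≤s (s≤s z≤n)) = refl

1⊕s≡1∸s : ∀ {s} → s < 2 → 1 ⊕ s ≡ 1 ∸ s
1⊕s≡1∸s (s≤s z≤n)       = refl
1⊕s≡1∸s (s≤s (s≤s z≤n)) = refl

parity : ℕ → ℕ
parity n = binDigitSum n % 2

parity<2 : ∀ n → parity n < 2
parity<2 n = m%n<n (binDigitSum n) 2

parity-0 : parity 0 ≡ 0
parity-0 = cong (_% 2) (binDigitSum-fromDigits [])

parity-+* : ∀ {r} n → r < 2 → parity (r + n * 2) ≡ r ⊕ parity n
parity-+* {r} n r<2 = begin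
  binDigitSum (r + n * 2) % 2   ≡⟨ cong (_% 2) (binDigitSum-+* n r<2) ⟩
  (r + binDigitSum n) % 2       ≡⟨ %-distribˡ-+ r (binDigitSum n) 2 ⟩
  r % 2 ⊕ parity n              ≡⟨ cong (_⊕ parity n) (m<n⇒m%n≡m r<2) ⟩
  r ⊕ parity n                  ∎
  where open ≡-Reasoning

parity-half : ∀ n → parity n ≡ n % 2 ⊕ parity (n / 2)
parity-half n = trans (cong parity (m≡m%n+[m/n]*n n 2)) (parity-+* (n / 2) (m%n<n n 2))

[1+k]/2≤k : ∀ k → suc k / 2 ≤ k
[1+k]/2≤k k = s≤s⁻¹ (m/n<m (suc k) 2 (s≤s (s≤s z≤n)))

module _ {g : ℕ → ℕ} (g<2 : ∀ n → g n < 2) (g-0 : g 0 ≡ 0)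
         (g-half : ∀ n → g n ≡ n % 2 ⊕ g (n / 2)) where

  tmFuel-unique : ∀ f n → n ≤ f → tmFuel f n ≡ g n
  tmFuel-unique zero    zero    _         = sym g-0
  tmFuel-unique (suc f) zero    _         = sym g-0
  tmFuel-unique (suc f) (suc k) (s≤s k≤f) with suc k % 2 in lowestBit
  ... | zero        = begin
    tmFuel f (suc k / 2)         ≡⟨ tmFuel-unique f _ (≤-trans ([1+k]/2≤k k) k≤f) ⟩
    g (suc k / 2)                ≡⟨ m<n⇒m%n≡m (g<2 (suc k / 2)) ⟨
    0 ⊕ g (suc k / 2)            ≡⟨ trans (g-half (suc k)) (cong (_⊕ g (suc k / 2)) lowestBit) ⟨
    g (suc k)                    ∎
    where open ≡-Reasoning
  ... | suc zero    = begin
    1 ∸ tmFuel f (suc k / 2)     ≡⟨ cong (1 ∸_) (tmFuel-unique f _ (≤-trans ([1+k]/2≤k k) k≤f)) ⟩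
    1 ∸ g (suc k / 2)            ≡⟨ 1⊕s≡1∸s (g<2 (suc k / 2)) ⟨
    1 ⊕ g (suc k / 2)            ≡⟨ trans (g-half (suc k)) (cong (_⊕ g (suc k / 2)) lowestBit) ⟨
    g (suc k)                    ∎
    where open ≡-Reasoning
  ... | suc (suc _) = contradiction (subst (_< 2) lowestBit (m%n<n (suc k) 2)) λ { (s≤s (s≤s ())) }

t≡parity : ∀ n → t n ≡ parity n
t≡parity n = tmFuel-unique parity<2 parity-0 parity-half n n ≤-refl

increasingEnumeration-≤ : ∀ {P f g} → IsIncreasingEnumeration P f → IsIncreasingEnumeration P g →
                          ∀ n → (∀ {i} → i < n → f i ≡ g i) → g n ≤ f n
increasingEnumeration-≤ {f = f} (f-inc , f∈P , _) (g-inc , _ , g-onto) n agree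
  with g-onto (f n) (f∈P n)
... | k , gk≡fn with <-cmp n k
...   | tri< n<k _ _ = ≤-trans (<⇒≤ (g-inc n k n<k)) (≤-reflexive gk≡fn)
...   | tri≈ _ refl _ = ≤-reflexive gk≡fn
...   | tri> _ _ k<n = contradiction (trans (agree k<n) gk≡fn) (<⇒≢ (f-inc k n k<n))

increasingEnumeration-unique : ∀ {P f g} → IsIncreasingEnumeration P f → IsIncreasingEnumeration P g →
                               ∀ n → f n ≡ g n
increasingEnumeration-unique {f = f} {g} f-enum g-enum = <-rec (λ n → f n ≡ g n) λ n agree →
  ≤-antisym (increasingEnumeration-≤ g-enum f-enum n (λ i<n → sym (agree i<n)))
            (increasingEnumeration-≤ f-enum g-enum n agree)

nthWithParity : ℕ → ℕ → ℕ
nthWithParity s n = s ⊕ parity n + n * 2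

bit+double-< : ∀ {r s m n} → r < 2 → m < n → r + m * 2 < s + n * 2
bit+double-< {r} {s} {m} {n} r<2 m<n = begin-strict
  r + m * 2   <⟨ +-monoˡ-< (m * 2) r<2 ⟩
  suc m * 2   ≤⟨ *-monoˡ-≤ 2 m<n ⟩
  n * 2       ≤⟨ m≤n+m (n * 2) s ⟩
  s + n * 2   ∎
  where open ≤-Reasoning

nthWithParity-enumeration : ∀ {s} → s < 2 →
                            IsIncreasingEnumeration (λ m → parity m ≡ s) (nthWithParity s)
nthWithParity-enumeration {s} s<2 = increasing , hasParity , onto
  where
  increasing : ∀ m n → m < n → nthWithParity s m < nthWithParity s n
  increasing m n = bit+double-< (⊕<2 s (parity m))

  hasParity : ∀ n → parity (nthWithParity s n) ≡ s
  hasParity n = trans (parity-+* n (⊕<2 s (parity n))) (⊕-cancelʳ s<2 (parity<2 n))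

  onto : ∀ m → parity m ≡ s → ∃ λ n → nthWithParity s n ≡ m
  onto m refl = m / 2 , (begin
    parity m ⊕ parity (m / 2) + m / 2 * 2                ≡⟨ cong (λ p → p ⊕ parity (m / 2) + m / 2 * 2) (parity-half m) ⟩
    m % 2 ⊕ parity (m / 2) ⊕ parity (m / 2) + m / 2 * 2  ≡⟨ cong (_+ m / 2 * 2) (⊕-cancelʳ (m%n<n m 2) (parity<2 (m / 2))) ⟩
    m % 2 + m / 2 * 2                                    ≡⟨ m≡m%n+[m/n]*n m 2 ⟨
    m                                                    ∎)
    where open ≡-Reasoning

nthWithParity-≡ : ∀ s m {q} → parity m ≡ q → nthWithParity s m ≡ 2 * m + (s ⊕ q)
nthWithParity-≡ s m refl = trans (+-comm (s ⊕ parity m) (m * 2)) (cong (_+ (s ⊕ parity m)) (*-comm m 2))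

pos-cancelʳ : ∀ m n x → + (m + x) - + (n + x) ≡ + m - + n
pos-cancelʳ m n x = begin
  + (m + x) - + (n + x)   ≡⟨ ℤₚ.[+m]-[+n]≡m⊖n (m + x) (n + x) ⟩
  (m + x) ⊖ (n + x)       ≡⟨ cong₂ _⊖_ (+-comm m x) (+-comm n x) ⟩
  (x + m) ⊖ (x + n)       ≡⟨ ℤₚ.+-cancelˡ-⊖ x m n ⟩
  m ⊖ n                   ≡⟨ ℤₚ.[+m]-[+n]≡m⊖n m n ⟨
  + m - + n               ∎
  where open ≡-Reasoning

+m≡+[m+1]-1 : ∀ m → + m ≡ + (m + 1) - + 1
+m≡+[m+1]-1 m = sym (trans (pos-cancelʳ m 0 1) (ℤₚ.+-identityʳ (+ m)))

nthWithParity-difference : ∀ n → + nthWithParity 1 n - + nthWithParity 0 n ≡ + 1 - + (2 * t n)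
nthWithParity-difference n = trans (difference (parity<2 n)) (cong (λ p → + 1 - + (2 * p)) (sym (t≡parity n)))
  where
  difference : ∀ {p} → p < 2 → + (1 ⊕ p + n * 2) - + (0 ⊕ p + n * 2) ≡ + 1 - + (2 * p)
  difference (s≤s z≤n)       = pos-cancelʳ 1 0 (n * 2)
  difference (s≤s (s≤s z≤n)) = pos-cancelʳ 0 1 (n * 2)

doubled-difference : ∀ x y t → + x - + y ≡ + 1 - + (2 * t) →
                     + (2 * y + 1) - + (2 * x + 1) ≡ + (4 * t) - + 2
doubled-difference x y t x-y = begin
  + (2 * y + 1) - + (2 * x + 1)                ≡⟨ cong₂ _-_ (pos-2*+1 y) (pos-2*+1 x) ⟩
  (+ 2 ℤ.* + y ℤ.+ + 1) - (+ 2 ℤ.* + x ℤ.+ + 1) ≡⟨ expand (+ x) (+ y) ⟩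
  - (+ 2 ℤ.* (+ x - + y))                      ≡⟨ cong (λ d → - (+ 2 ℤ.* d)) x-y ⟩
  - (+ 2 ℤ.* (+ 1 - + (2 * t)))                ≡⟨ cong (λ d → - (+ 2 ℤ.* (+ 1 - d))) (ℤₚ.pos-* 2 t) ⟩
  - (+ 2 ℤ.* (+ 1 - + 2 ℤ.* + t))              ≡⟨ collect (+ t) ⟩
  + 4 ℤ.* + t - + 2                            ≡⟨ cong (_- + 2) (ℤₚ.pos-* 4 t) ⟨
  + (4 * t) - + 2                              ∎
  where
  open ≡-Reasoning
  pos-2*+1 : ∀ m → + (2 * m + 1) ≡ + 2 ℤ.* + m ℤ.+ + 1
  pos-2*+1 m = trans (ℤₚ.pos-+ (2 * m) 1) (cong (ℤ._+ + 1) (ℤₚ.pos-* 2 m))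
  expand : ∀ (X Y : ℤ) → (+ 2 ℤ.* Y ℤ.+ + 1) - (+ 2 ℤ.* X ℤ.+ + 1) ≡ - (+ 2 ℤ.* (X - Y))
  expand = solve-∀
  collect : ∀ (T : ℤ) → - (+ 2 ℤ.* (+ 1 - + 2 ℤ.* T)) ≡ + 4 ℤ.* T - + 2
  collect = solve-∀

corollary5p1 : (a b : ℕ → ℕ) →
    IsIncreasingEnumeration Odious a →
    IsIncreasingEnumeration Evil b →
    ∀ n →
      (a (a n) ≡ 2 * a n) ×
      (b (b n) ≡ 2 * b n) ×
      (a (b n) ≡ 2 * b n + 1) ×
      (b (a n) ≡ 2 * a n + 1) ×
      ((+ a (a n)) ≡ (+ b (a n)) - (+ 1)) ×
      ((+ b (b n)) ≡ (+ a (b n)) - (+ 1)) ×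
      ((+ a n) - (+ b n) ≡ (+ 1) - (+ (2 * t n))) ×
      ((+ a (b n)) - (+ b (a n)) ≡ (+ (4 * t n)) - (+ 2))
corollary5p1 a b a-enum b-enum n = i , ii , iii , iv , v , vi , vii , viii
  where
  a≡odd : ∀ m → a m ≡ nthWithParity 1 m
  a≡odd = increasingEnumeration-unique a-enum (nthWithParity-enumeration (s≤s (s≤s z≤n)))
  b≡even : ∀ m → b m ≡ nthWithParity 0 m
  b≡even = increasingEnumeration-unique b-enum (nthWithParity-enumeration (s≤s z≤n))
  a-odious : Odious (a n)
  a-odious = proj₁ (proj₂ a-enum) n
  b-evil : Evil (b n)
  b-evil = proj₁ (proj₂ b-enum) n
  i : a (a n) ≡ 2 * a n
  i = trans (a≡odd (a n)) (trans (nthWithParity-≡ 1 (a n) a-odious) (+-identityʳ (2 * a n)))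
  ii : b (b n) ≡ 2 * b n
  ii = trans (b≡even (b n)) (trans (nthWithParity-≡ 0 (b n) b-evil) (+-identityʳ (2 * b n)))
  iii : a (b n) ≡ 2 * b n + 1
  iii = trans (a≡odd (b n)) (nthWithParity-≡ 1 (b n) b-evil)
  iv : b (a n) ≡ 2 * a n + 1
  iv = trans (b≡even (a n)) (nthWithParity-≡ 0 (a n) a-odious)
  v : (+ a (a n)) ≡ (+ b (a n)) - (+ 1)
  v = subst₂ (λ x y → + x ≡ + y - + 1) (sym i) (sym iv) (+m≡+[m+1]-1 (2 * a n))
  vi : (+ b (b n)) ≡ (+ a (b n)) - (+ 1)
  vi = subst₂ (λ x y → + x ≡ + y - + 1) (sym ii) (sym iii) (+m≡+[m+1]-1 (2 * b n))
  vii : (+ a n) - (+ b n) ≡ (+ 1) - (+ (2 * t n))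
  vii = trans (cong₂ (λ x y → + x - + y) (a≡odd n) (b≡even n)) (nthWithParity-difference n)
  viii : (+ a (b n)) - (+ b (a n)) ≡ (+ (4 * t n)) - (+ 2)
  viii = trans (cong₂ (λ x y → + x - + y) iii iv) (doubled-difference (a n) (b n) (t n) vii)
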